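{- For every $n\geq 4$, there is a sphere triangulation with $n$ vertices that has a non-rainbow coloring with $\left\lfloor\frac{2n-1}{3}\right\rfloor$ colors.
   Context: A sphere triangulation is a simple graph embedded in the sphere all of whose faces are triangles (a maximal planar graph). A coloring with $k$ colors is a surjective map $V\to\{1,\dots,k\}$ (not necessarily proper). A face is rainbow if its vertices receive mutually distinct colors; a coloring is non-rainbow if no face is rainbow. -}

module Defs where

open import Data.Nat using (ℕ; zero; suc; _+_; _*_; _∸_; _≤_; _<_)
open import Data.Nat.DivMod using (_%_; m%n<n)
open import Data.Fin using (Fin; toℕ; fromℕ<) renaming (_<_ to _<ᶠ_; _≟_ to _≟ᶠ_)
open import Data.Bool using (Bool; true; false; _∨_; _∧_)
open import Data.List using (List; []; _∷_; length; concatMap; allFin)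
open import Data.List.Membership.Propositional using (_∈_)
open import Data.List.Relation.Unary.All using (All)
open import Data.List.Relation.Unary.Any using (any?)
open import Data.List.Relation.Unary.Unique.Propositional using (Unique)
open import Data.Product using (Σ; ∃; _×_; _,_)
open import Data.Sum using (_⊎_)
open import Relation.Nullary using (¬_; does)
open import Relation.Binary.PropositionalEquality using (_≡_; _≢_)
open import Function.Definitions using (Injective)

-- Faces are required to be stored sorted (a < b < c), so a face is a 3-element
-- vertex set and equal faces are equal triples.
Tri : ℕ → Set
Tri n = Fin n × Fin n × Fin n

Sorted : ∀ {n} → Tri n → Set
Sorted (a , b , c) = (a <ᶠ b) × (b <ᶠ c)

_∈ᵥ_ : ∀ {n} → Fin n → Tri n → Set
x ∈ᵥ (a , b , c) = x ≡ a ⊎ x ≡ b ⊎ x ≡ c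

SameSet : ∀ {n} → Tri n → Fin n → Fin n → Fin n → Set
SameSet t u v w = ∀ x → (x ∈ᵥ t → x ≡ u ⊎ x ≡ v ⊎ x ≡ w) × (x ≡ u ⊎ x ≡ v ⊎ x ≡ w → x ∈ᵥ t)

next : ∀ {m} → Fin (3 + m) → Fin (3 + m)
next {m} i = fromℕ< (m%n<n (suc (toℕ i)) (3 + m))

LinkIsCycle : ∀ {n} → List (Tri n) → Fin n → Set
LinkIsCycle {n} F v =
  Σ ℕ λ m → Σ (Fin (3 + m) → Fin n) λ w →
      Injective _≡_ _≡_ w
    × (∀ i → w i ≢ v)
    × (∀ i → Σ (Tri n) λ t → t ∈ F × SameSet t v (w i) (w (next i)))
    × (∀ t → t ∈ F → v ∈ᵥ t → Σ (Fin (3 + m)) λ i → SameSet t v (w i) (w (next i)))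

Adj : ∀ {n} → List (Tri n) → Fin n → Fin n → Set
Adj F u v = u ≢ v × Σ _ λ t → t ∈ F × u ∈ᵥ t × v ∈ᵥ t

data Reach {n} (F : List (Tri n)) : Fin n → Fin n → Set where
  here : ∀ {u} → Reach F u u
  step : ∀ {u v w} → Adj F u v → Reach F v w → Reach F u w

Connected : ∀ {n} → List (Tri n) → Set
Connected {n} F = ∀ (u v : Fin n) → Reach F u v

_∈ᵥᵇ_ : ∀ {n} → Fin n → Tri n → Bool
x ∈ᵥᵇ (a , b , c) = does (x ≟ᶠ a) ∨ does (x ≟ᶠ b) ∨ does (x ≟ᶠ c)

countᵇ : ∀ {A : Set} → (A → Bool) → List A → ℕ
countᵇ p [] = 0
countᵇ p (x ∷ xs) with p x
... | true  = suc (countᵇ p xs)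
... | false = countᵇ p xs

isEdgeᵇ : ∀ {n} → List (Tri n) → Fin n → Fin n → Bool
isEdgeᵇ [] u v = false
isEdgeᵇ (t ∷ F) u v = ((u ∈ᵥᵇ t) ∧ (v ∈ᵥᵇ t)) ∨ isEdgeᵇ F u v

edgeCount : ∀ {n} → List (Tri n) → ℕ
edgeCount {n} F =
  countᵇ (λ p → isEdge p) (concatMap (λ i → Data.List.map (λ j → (i , j)) (allFin n)) (allFin n))
  where
    import Data.List
    isEdge : Fin n × Fin n → Bool
    isEdge (u , v) = does (Data.Nat._<?_ (toℕ u) (toℕ v)) ∧ isEdgeᵇ F u v
      where import Data.Nat

-- A sphere triangulation on vertex set Fin n, given by its list of (triangular) faces:
-- a connected closed combinatorial surface (every vertex link is a cycle) with
-- Euler characteristic V − E + F = 2, i.e. a simplicial 2-sphere.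
IsSphereTriangulation : ∀ {n} → List (Tri n) → Set
IsSphereTriangulation {n} F =
    All Sorted F
  × Unique F
  × (∀ v → LinkIsCycle F v)
  × Connected F
  × (n + length F ≡ 2 + edgeCount F)

Surjective : ∀ {n k} → (Fin n → Fin k) → Set
Surjective {n} {k} c = ∀ (y : Fin k) → Σ (Fin n) λ x → c x ≡ y

Rainbow : ∀ {n k} → (Fin n → Fin k) → Tri n → Set
Rainbow c (a , b , d) = c a ≢ c b × c b ≢ c d × c a ≢ c d

NonRainbow : ∀ {n k} → List (Tri n) → (Fin n → Fin k) → Set
NonRainbow F c = ∀ t → t ∈ F → ¬ Rainbow c t

-- Start from the tetrahedron and repeatedly stack, i.e. put a new vertex into a face and join it
-- to the three corners. Stacking keeps a sphere triangulation (the new vertex has a triangular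
-- link, and in the link cycle of each corner the old face is replaced by the two new faces at that
-- corner) and adds one vertex, two faces and three edges. Stacking a times gives a + 4 vertices
-- and 2a + 4 faces; stack r ≤ 2a + 4 more vertices into r distinct faces of that triangulation.
-- Colour these r vertices with distinct colours and every other vertex with one further colour:
-- each face keeps two old vertices, so no face is rainbow. For n = r + a + 4 ≥ 6 the parameters
-- can be chosen with r + 1 = ⌊(2n − 1)/3⌋; the cases n = 4, 5 are checked directly.

module Submission where

open import Defs
open import Data.Nat.ListAction using (sum)
open import Data.Nat using (ℕ; zero; suc; _<ᵇ_; _+_; _*_; _∸_; _≤_; _<_; z≤n; s≤s)
open import Data.Nat.Properties
open import Data.Nat.DivMod using (_/_; _%_; m%n<n; m<n⇒m%n≡m; n%n≡0; /-congˡ; m/n≡1+[m∸n]/n)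
open import Data.Fin using (Fin; zero; suc; #_; toℕ; fromℕ; fromℕ<; inject₁) renaming (_≟_ to _≟ᶠ_)
import Data.Fin.Properties as Fin
open import Data.Product using (Σ; _×_; _,_; proj₁; proj₂)
open import Data.Sum using (_⊎_; inj₁; inj₂)
open import Data.Empty using (⊥-elim)
open import Data.Bool using (Bool; true; false; T; _∨_; _∧_)
import Data.Bool.Properties as Bool
open import Data.List using (List; []; _∷_; length; map; _++_; concatMap; allFin)
open import Data.List.Properties using (map-tabulate; map-cong; map-∘; map-++; length-map; length-++; ++-assoc; ++-identityʳ)
open import Data.List.Membership.Propositional using (_∈_; find; lose)
open import Data.List.Membership.Propositional.Properties using (∈-map⁻)
open import Data.List.Relation.Unary.All using (All; []; _∷_)
import Data.List.Relation.Unary.All as All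
import Data.List.Relation.Unary.All.Properties as All
open import Data.List.Relation.Unary.Any using (Any; here; there)
import Data.List.Relation.Unary.Any as Any
import Data.List.Relation.Unary.Any.Properties as Any
open import Data.List.Relation.Unary.AllPairs using ([]; _∷_)
import Data.List.Relation.Unary.AllPairs as AllPairs
open import Data.Product.Properties using (≡-dec)
open import Data.List.Relation.Unary.Unique.Propositional using (Unique)
import Data.List.Relation.Unary.Unique.Propositional.Properties as Unique
open import Function using (_∘_; _⇔_; mk⇔; Equivalence)
open import Function.Properties.Equivalence using () renaming (trans to ⇔-trans; sym to ⇔-sym)
open import Function.Properties.Inverse using (↔⇒⇔)
open import Data.Sum.Function.Propositional using (_⊎-cong_)
open import Data.Product.Function.NonDependent.Propositional using (_×-cong_)
open import Function.Definitions using (Injective)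
open import Relation.Nullary using (¬_; ¬?; Dec; yes; no; does)
open import Relation.Nullary.Decidable using (map′; from-yes; _×-dec_; _⊎-dec_; _→-dec_)
open import Relation.Binary.PropositionalEquality using (_≡_; _≢_; refl; sym; trans; cong; cong₂; subst; subst₂; module ≡-Reasoning)

last : ∀ m → Fin (3 + m)
last m = fromℕ (2 + m)

toℕ-next : ∀ {m} (i : Fin (3 + m)) → toℕ (next i) ≡ suc (toℕ i) % (3 + m)
toℕ-next {m} i = Fin.toℕ-fromℕ< (m%n<n (suc (toℕ i)) (3 + m))

toℕ-next-< : ∀ {m} (i : Fin (3 + m)) → suc (toℕ i) < 3 + m → toℕ (next i) ≡ suc (toℕ i)
toℕ-next-< i p = trans (toℕ-next i) (m<n⇒m%n≡m p)

next-last : ∀ m → next (last m) ≡ zero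
next-last m = Fin.toℕ-injective (begin
  toℕ (next (last m))          ≡⟨ toℕ-next (last m) ⟩
  suc (toℕ (last m)) % (3 + m) ≡⟨ cong (λ k → suc k % (3 + m)) (Fin.toℕ-fromℕ (2 + m)) ⟩
  (3 + m) % (3 + m)            ≡⟨ n%n≡0 (3 + m) ⟩
  0                            ∎)
  where open ≡-Reasoning

last-or-< : ∀ {m} (i : Fin (3 + m)) → i ≡ last m ⊎ suc (toℕ i) < 3 + m
last-or-< {m} i with m≤n⇒m<n∨m≡n (Fin.toℕ<n i)
... | inj₁ i+1<3+m = inj₂ i+1<3+m
... | inj₂ i+1≡3+m = inj₁ (Fin.toℕ-injective (trans (suc-injective i+1≡3+m) (sym (Fin.toℕ-fromℕ (2 + m)))))

prev : ∀ {m} → Fin (3 + m) → Fin (3 + m)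
prev {m} zero = last m
prev (suc j) = inject₁ j

next-prev : ∀ {m} (i : Fin (3 + m)) → next (prev i) ≡ i
next-prev {m} zero = next-last m
next-prev {m} (suc j) = Fin.toℕ-injective (trans (toℕ-next-< (inject₁ j) j+1<3+m) (cong suc (Fin.toℕ-inject₁ j)))
  where
  j+1<3+m : suc (toℕ (inject₁ j)) < 3 + m
  j+1<3+m = s≤s (subst (_< 2 + m) (sym (Fin.toℕ-inject₁ j)) (Fin.toℕ<n j))

prev-next : ∀ {m} (i : Fin (3 + m)) → prev (next i) ≡ i
prev-next {m} i with last-or-< i
... | inj₁ refl = cong prev (next-last m)
... | inj₂ i+1<3+m = prev-of (next i) (toℕ-next-< i i+1<3+m)
  where
  prev-of : ∀ k → toℕ k ≡ suc (toℕ i) → prev k ≡ i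
  prev-of (suc k) k≡i+1 = Fin.toℕ-injective (trans (Fin.toℕ-inject₁ k) (suc-injective k≡i+1))

next-injective : ∀ {m} → Injective _≡_ _≡_ (next {m})
next-injective {x = i} {j} e = trans (sym (prev-next i)) (trans (cong prev e) (prev-next j))

toℕ-next-zero : ∀ {m} → toℕ (next {m} zero) ≡ 1
toℕ-next-zero {m} = toℕ-next-< {m} zero (s≤s (s≤s z≤n))

next-zero-≢-last : ∀ {m} → next zero ≢ last m
next-zero-≢-last {m} e = 0≢1+n (suc-injective (trans (sym (toℕ-next-zero {m})) (trans (cong toℕ e) (Fin.toℕ-fromℕ (2 + m)))))

next-≢ : ∀ {m} (i : Fin (3 + m)) → next i ≢ i
next-≢ {m} i e with last-or-< i
... | inj₁ refl = Fin.0≢1+n (trans (sym (next-last m)) e)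
... | inj₂ i+1<3+m = 1+n≢n (trans (sym (toℕ-next-< i i+1<3+m)) (cong toℕ e))

next-next-≢ : ∀ {m} (i : Fin (3 + m)) → next (next i) ≢ i
next-next-≢ {m} i e with last-or-< i | last-or-< (next i)
... | inj₁ refl | _ = next-zero-≢-last (trans (cong next (sym (next-last m))) e)
... | inj₂ _ | inj₁ next-i≡last = next-zero-≢-last (trans (cong next zero≡i) next-i≡last)
  where
  zero≡i : zero ≡ i
  zero≡i = trans (sym (next-last m)) (trans (cong next (sym next-i≡last)) e)
... | inj₂ i+1<3+m | inj₂ i+2<3+m = n≢2+n (trans (sym (cong toℕ e))
         (trans (toℕ-next-< (next i) i+2<3+m) (cong suc (toℕ-next-< i i+1<3+m))))
  where
  n≢2+n : ∀ {k} → k ≢ 2 + k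
  n≢2+n ()

next-zero : ∀ {m} → next {m} zero ≡ suc zero
next-zero {m} = Fin.toℕ-injective (toℕ-next-zero {m})

next-suc : ∀ {m} (j : Fin (3 + m)) → suc (toℕ j) < 3 + m → next {suc m} (suc j) ≡ suc (next j)
next-suc j j+1<3+m = Fin.toℕ-injective (trans (toℕ-next-< (suc j) (s≤s j+1<3+m)) (cong suc (sym (toℕ-next-< j j+1<3+m))))

infix 4 _≈ᵗ_

_≈ᵗ_ : ∀ {n} → Tri n → Tri n → Set
s ≈ᵗ t = ∀ x → (x ∈ᵥ s → x ∈ᵥ t) × (x ∈ᵥ t → x ∈ᵥ s)

≈ᵗ-refl : ∀ {n} {t : Tri n} → t ≈ᵗ t
≈ᵗ-refl x = (λ p → p) , (λ p → p)

≈ᵗ-sym : ∀ {n} {s t : Tri n} → s ≈ᵗ t → t ≈ᵗ s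
≈ᵗ-sym e x = proj₂ (e x) , proj₁ (e x)

≈ᵗ-trans : ∀ {n} {s t u : Tri n} → s ≈ᵗ t → t ≈ᵗ u → s ≈ᵗ u
≈ᵗ-trans e f x = (λ p → proj₁ (f x) (proj₁ (e x) p)) , (λ p → proj₂ (e x) (proj₂ (f x) p))

swap₁₂ : ∀ {n} {a b c : Fin n} → (a , b , c) ≈ᵗ (b , a , c)
swap₁₂ x = flip , flip
  where
  flip : ∀ {a b c} → x ∈ᵥ (a , b , c) → x ∈ᵥ (b , a , c)
  flip (inj₁ p) = inj₂ (inj₁ p)
  flip (inj₂ (inj₁ p)) = inj₁ p
  flip (inj₂ (inj₂ p)) = inj₂ (inj₂ p)

swap₂₃ : ∀ {n} {a b c : Fin n} → (a , b , c) ≈ᵗ (a , c , b)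
swap₂₃ x = flip , flip
  where
  flip : ∀ {a b c} → x ∈ᵥ (a , b , c) → x ∈ᵥ (a , c , b)
  flip (inj₁ p) = inj₁ p
  flip (inj₂ (inj₁ p)) = inj₂ (inj₂ p)
  flip (inj₂ (inj₂ p)) = inj₂ (inj₁ p)

_∈ᵥ?_ : ∀ {n} (x : Fin n) (t : Tri n) → Dec (x ∈ᵥ t)
x ∈ᵥ? (a , b , c) = x ≟ᶠ a ⊎-dec x ≟ᶠ b ⊎-dec x ≟ᶠ c

_≈ᵗ?_ : ∀ {n} (s t : Tri n) → Dec (s ≈ᵗ t)
(a , b , c) ≈ᵗ? t′@(a′ , b′ , c′) = map′ fromCorners toCorners
  (a ∈ᵥ? t′ ×-dec b ∈ᵥ? t′ ×-dec c ∈ᵥ? t′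
    ×-dec a′ ∈ᵥ? (a , b , c) ×-dec b′ ∈ᵥ? (a , b , c) ×-dec c′ ∈ᵥ? (a , b , c))
  where
  fromCorners : _ → (a , b , c) ≈ᵗ t′
  fromCorners (pa , pb , pc , pa′ , pb′ , pc′) x =
      (λ { (inj₁ refl) → pa ; (inj₂ (inj₁ refl)) → pb ; (inj₂ (inj₂ refl)) → pc })
    , (λ { (inj₁ refl) → pa′ ; (inj₂ (inj₁ refl)) → pb′ ; (inj₂ (inj₂ refl)) → pc′ })
  toCorners : (a , b , c) ≈ᵗ t′ → _
  toCorners e = proj₁ (e a) (inj₁ refl) , proj₁ (e b) (inj₂ (inj₁ refl)) , proj₁ (e c) (inj₂ (inj₂ refl))
              , proj₂ (e a′) (inj₁ refl) , proj₂ (e b′) (inj₂ (inj₁ refl)) , proj₂ (e c′) (inj₂ (inj₂ refl))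

min≤ : ∀ {n} {a b c x : Fin n} → Sorted (a , b , c) → x ∈ᵥ (a , b , c) → toℕ a ≤ toℕ x
min≤ _ (inj₁ refl) = ≤-refl
min≤ (a<b , _) (inj₂ (inj₁ refl)) = <⇒≤ a<b
min≤ (a<b , b<c) (inj₂ (inj₂ refl)) = <⇒≤ (<-trans a<b b<c)

≤max : ∀ {n} {a b c x : Fin n} → Sorted (a , b , c) → x ∈ᵥ (a , b , c) → toℕ x ≤ toℕ c
≤max (a<b , b<c) (inj₁ refl) = <⇒≤ (<-trans a<b b<c)
≤max (_ , b<c) (inj₂ (inj₁ refl)) = <⇒≤ b<c
≤max _ (inj₂ (inj₂ refl)) = ≤-refl

sorted-≈ᵗ⇒≡ : ∀ {n} {s t : Tri n} → Sorted s → Sorted t → s ≈ᵗ t → s ≡ t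
sorted-≈ᵗ⇒≡ {s = a , b , c} {a′ , b′ , c′} s↑ t↑ e = cong₂ _,_ a≡a′ (cong₂ _,_ b≡b′ c≡c′)
  where
  a≡a′ : a ≡ a′
  a≡a′ = Fin.toℕ-injective (≤-antisym (min≤ s↑ (proj₂ (e a′) (inj₁ refl))) (min≤ t↑ (proj₁ (e a) (inj₁ refl))))
  c≡c′ : c ≡ c′
  c≡c′ = Fin.toℕ-injective
    (≤-antisym (≤max t↑ (proj₁ (e c) (inj₂ (inj₂ refl)))) (≤max s↑ (proj₂ (e c′) (inj₂ (inj₂ refl)))))
  b≡b′ : b ≡ b′
  b≡b′ with proj₁ (e b) (inj₂ (inj₁ refl))
  ... | inj₁ b≡a′ = ⊥-elim (Fin.<⇒≢ (proj₁ s↑) (trans a≡a′ (sym b≡a′)))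
  ... | inj₂ (inj₁ b≡b′) = b≡b′
  ... | inj₂ (inj₂ b≡c′) = ⊥-elim (Fin.<⇒≢ (proj₂ s↑) (trans b≡c′ (sym c≡c′)))

-- Stacking a vertex into a face

sucᵗ : ∀ {n} → Tri n → Tri (suc n)
sucᵗ (a , b , c) = (suc a , suc b , suc c)

sucᵗ-injective : ∀ {n} → Injective _≡_ _≡_ (sucᵗ {n})
sucᵗ-injective {x = _ , _ , _} {_ , _ , _} refl = refl

∈-sucᵗ⁺ : ∀ {n} {x : Fin n} {t : Tri n} → x ∈ᵥ t → suc x ∈ᵥ sucᵗ t
∈-sucᵗ⁺ (inj₁ refl) = inj₁ refl
∈-sucᵗ⁺ (inj₂ (inj₁ refl)) = inj₂ (inj₁ refl)
∈-sucᵗ⁺ (inj₂ (inj₂ refl)) = inj₂ (inj₂ refl)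

∈-sucᵗ⁻ : ∀ {n} {x : Fin n} (t : Tri n) → suc x ∈ᵥ sucᵗ t → x ∈ᵥ t
∈-sucᵗ⁻ _ (inj₁ refl) = inj₁ refl
∈-sucᵗ⁻ _ (inj₂ (inj₁ refl)) = inj₂ (inj₁ refl)
∈-sucᵗ⁻ _ (inj₂ (inj₂ refl)) = inj₂ (inj₂ refl)

zero∉sucᵗ : ∀ {n} (t : Tri n) → ¬ (zero ∈ᵥ sucᵗ t)
zero∉sucᵗ _ (inj₁ ())
zero∉sucᵗ _ (inj₂ (inj₁ ()))
zero∉sucᵗ _ (inj₂ (inj₂ ()))

sucᵗ-≈ᵗ : ∀ {n} {s t : Tri n} → s ≈ᵗ t → sucᵗ s ≈ᵗ sucᵗ t
sucᵗ-≈ᵗ {s = s} {t} e zero = (λ p → ⊥-elim (zero∉sucᵗ s p)) , (λ p → ⊥-elim (zero∉sucᵗ t p))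
sucᵗ-≈ᵗ {s = s} {t} e (suc x) =
  (λ p → ∈-sucᵗ⁺ (proj₁ (e x) (∈-sucᵗ⁻ s p))) , (λ p → ∈-sucᵗ⁺ (proj₂ (e x) (∈-sucᵗ⁻ t p)))

cone : ∀ {n} → Tri n → List (Tri (suc n))
cone (a , b , c) = (zero , suc a , suc b) ∷ (zero , suc b , suc c) ∷ (zero , suc a , suc c) ∷ []

-- The new vertex is 0 (old vertices are shifted up by one) and it is stacked into the head face.
stack : ∀ {n} → List (Tri n) → List (Tri (suc n))
stack [] = []
stack (t ∷ F) = map sucᵗ F ++ cone t

∈-cone⁻ : ∀ {n} {u : Fin n} (t : Tri n) {f} → f ∈ cone t → suc u ∈ᵥ f → u ∈ᵥ t
∈-cone⁻ _ (here refl) (inj₂ (inj₁ refl)) = inj₁ refl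
∈-cone⁻ _ (here refl) (inj₂ (inj₂ refl)) = inj₂ (inj₁ refl)
∈-cone⁻ _ (there (here refl)) (inj₂ (inj₁ refl)) = inj₂ (inj₁ refl)
∈-cone⁻ _ (there (here refl)) (inj₂ (inj₂ refl)) = inj₂ (inj₂ refl)
∈-cone⁻ _ (there (there (here refl))) (inj₂ (inj₁ refl)) = inj₁ refl
∈-cone⁻ _ (there (there (here refl))) (inj₂ (inj₂ refl)) = inj₂ (inj₂ refl)

cone-face : ∀ {n} {t : Tri n} {x y} → x ∈ᵥ t → y ∈ᵥ t → x ≢ y
  → Σ (Tri (suc n)) λ f → f ∈ cone t × f ≈ᵗ (zero , suc x , suc y)
cone-face (inj₁ refl) (inj₁ refl) x≢y = ⊥-elim (x≢y refl)
cone-face (inj₁ refl) (inj₂ (inj₁ refl)) _ = _ , here refl , ≈ᵗ-refl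
cone-face (inj₁ refl) (inj₂ (inj₂ refl)) _ = _ , there (there (here refl)) , ≈ᵗ-refl
cone-face (inj₂ (inj₁ refl)) (inj₁ refl) _ = _ , here refl , swap₂₃
cone-face (inj₂ (inj₁ refl)) (inj₂ (inj₁ refl)) x≢y = ⊥-elim (x≢y refl)
cone-face (inj₂ (inj₁ refl)) (inj₂ (inj₂ refl)) _ = _ , there (here refl) , ≈ᵗ-refl
cone-face (inj₂ (inj₂ refl)) (inj₁ refl) _ = _ , there (there (here refl)) , swap₂₃
cone-face (inj₂ (inj₂ refl)) (inj₂ (inj₁ refl)) _ = _ , there (here refl) , swap₂₃
cone-face (inj₂ (inj₂ refl)) (inj₂ (inj₂ refl)) x≢y = ⊥-elim (x≢y refl)

cone-cover : ∀ {n} {a b c : Fin n} → Sorted (a , b , c) → ∀ {u f} → f ∈ cone (a , b , c) → suc u ∈ᵥ f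
  → Σ (Fin n) λ z → z ∈ᵥ (a , b , c) × z ≢ u × f ≈ᵗ (zero , suc u , suc z)
cone-cover (a<b , b<c) (here refl) (inj₂ (inj₁ refl)) = _ , inj₂ (inj₁ refl) , Fin.<⇒≢ a<b ∘ sym , ≈ᵗ-refl
cone-cover (a<b , b<c) (here refl) (inj₂ (inj₂ refl)) = _ , inj₁ refl , Fin.<⇒≢ a<b , swap₂₃
cone-cover (a<b , b<c) (there (here refl)) (inj₂ (inj₁ refl)) = _ , inj₂ (inj₂ refl) , Fin.<⇒≢ b<c ∘ sym , ≈ᵗ-refl
cone-cover (a<b , b<c) (there (here refl)) (inj₂ (inj₂ refl)) = _ , inj₂ (inj₁ refl) , Fin.<⇒≢ b<c , swap₂₃
cone-cover (a<b , b<c) (there (there (here refl))) (inj₂ (inj₁ refl)) =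
  _ , inj₂ (inj₂ refl) , Fin.<⇒≢ (<-trans a<b b<c) ∘ sym , ≈ᵗ-refl
cone-cover (a<b , b<c) (there (there (here refl))) (inj₂ (inj₂ refl)) =
  _ , inj₁ refl , Fin.<⇒≢ (<-trans a<b b<c) , swap₂₃

IsLinkCycle : ∀ {n} → List (Tri n) → Fin n → (m : ℕ) → (Fin (3 + m) → Fin n) → Set
IsLinkCycle {n} F v m w =
    Injective _≡_ _≡_ w
  × (∀ i → w i ≢ v)
  × (∀ i → Σ (Tri n) λ t → t ∈ F × t ≈ᵗ (v , w i , w (next i)))
  × (∀ t → t ∈ F → v ∈ᵥ t → Σ (Fin (3 + m)) λ i → t ≈ᵗ (v , w i , w (next i)))

rotate : ∀ {n F v m w} → IsLinkCycle {n} F v m w → IsLinkCycle F v m (w ∘ next)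
rotate {F = F} {v} {m} {w} (w-inj , w≢v , faces , covers) =
  next-injective ∘ w-inj , w≢v ∘ next , faces ∘ next , covers′
  where
  covers′ : ∀ t → t ∈ F → v ∈ᵥ t → Σ (Fin (3 + m)) λ i → t ≈ᵗ (v , w (next i) , w (next (next i)))
  covers′ t t∈F v∈t with covers t t∈F v∈t
  ... | i , t≈ = prev i , subst (λ k → t ≈ᵗ (v , w k , w (next k))) (sym (next-prev i)) t≈

-- k = toℕ i is the termination measure.
rotate-to-last : ∀ {n F v m} k (w : Fin (3 + m) → Fin n) (i : Fin (3 + m)) {t} → toℕ i ≡ k
  → IsLinkCycle F v m w → t ≈ᵗ (v , w i , w (next i))
  → Σ (Fin (3 + m) → Fin n) λ w′ → IsLinkCycle F v m w′ × t ≈ᵗ (v , w′ (last m) , w′ zero)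
rotate-to-last {v = v} {m} _ w zero {t} _ cyc t≈ =
  w ∘ next , rotate cyc , subst (λ k → t ≈ᵗ (v , w k , w (next zero))) (sym (next-last m)) t≈
rotate-to-last {v = v} (suc k) w (suc j) {t} i≡k cyc t≈ =
  rotate-to-last k (w ∘ next) (inject₁ j) (trans (Fin.toℕ-inject₁ j) (suc-injective i≡k)) (rotate cyc)
    (subst (λ l → t ≈ᵗ (v , w l , w (next l))) (sym (next-prev (suc j))) t≈)

link-index-unique : ∀ {n F v m w} → IsLinkCycle {n} F v m w → ∀ {t i j}
  → t ≈ᵗ (v , w i , w (next i)) → t ≈ᵗ (v , w j , w (next j)) → i ≡ j
link-index-unique {v = v} {w = w} (w-inj , w≢v , _) {t} {i} {j} t≈i t≈j
  with proj₁ (t≈i (w j)) (proj₂ (t≈j (w j)) (inj₂ (inj₁ refl)))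
... | inj₁ wj≡v = ⊥-elim (w≢v j wj≡v)
... | inj₂ (inj₁ wj≡wi) = sym (w-inj wj≡wi)
... | inj₂ (inj₂ wj≡wi′) with w-inj wj≡wi′ | proj₁ (t≈i (w (next j))) (proj₂ (t≈j (w (next j))) (inj₂ (inj₂ refl)))
...   | refl | inj₁ w≡v = ⊥-elim (w≢v _ w≡v)
...   | refl | inj₂ (inj₁ w≡wi) = ⊥-elim (next-next-≢ i (w-inj w≡wi))
...   | refl | inj₂ (inj₂ w≡wi′) = ⊥-elim (next-≢ i (next-injective (w-inj w≡wi′)))

TriangleLink : ∀ {n} → List (Tri n) → Fin n → Fin n → Fin n → Fin n → Set
TriangleLink F v x y z =
    Any (_≈ᵗ (v , x , y)) F × Any (_≈ᵗ (v , y , z)) F × Any (_≈ᵗ (v , z , x)) F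
  × All (λ f → v ∈ᵥ f → f ≈ᵗ (v , x , y) ⊎ f ≈ᵗ (v , y , z) ⊎ f ≈ᵗ (v , z , x)) F

triangleLink? : ∀ {n} (F : List (Tri n)) v x y z → Dec (TriangleLink F v x y z)
triangleLink? F v x y z =
  Any.any? (_≈ᵗ? _) F ×-dec Any.any? (_≈ᵗ? _) F ×-dec Any.any? (_≈ᵗ? _) F
  ×-dec All.all? (λ f → v ∈ᵥ? f →-dec (f ≈ᵗ? _ ⊎-dec f ≈ᵗ? _ ⊎-dec f ≈ᵗ? _)) F

link-of-triangle : ∀ {n} {F : List (Tri n)} v x y z
  → x ≢ y → y ≢ z → x ≢ z → x ≢ v → y ≢ v → z ≢ v → TriangleLink F v x y z → LinkIsCycle F v
link-of-triangle {n} {F} v x y z x≢y y≢z x≢z x≢v y≢v z≢v (xy , yz , zx , covers) =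
  0 , w , w-inj , w≢v , faces , covers′
  where
  w : Fin 3 → Fin n
  w zero = x
  w (suc zero) = y
  w (suc (suc zero)) = z
  w-inj : Injective _≡_ _≡_ w
  w-inj {zero} {zero} _ = refl
  w-inj {zero} {suc zero} e = ⊥-elim (x≢y e)
  w-inj {zero} {suc (suc zero)} e = ⊥-elim (x≢z e)
  w-inj {suc zero} {zero} e = ⊥-elim (x≢y (sym e))
  w-inj {suc zero} {suc zero} _ = refl
  w-inj {suc zero} {suc (suc zero)} e = ⊥-elim (y≢z e)
  w-inj {suc (suc zero)} {zero} e = ⊥-elim (x≢z (sym e))
  w-inj {suc (suc zero)} {suc zero} e = ⊥-elim (y≢z (sym e))
  w-inj {suc (suc zero)} {suc (suc zero)} _ = refl
  w≢v : ∀ i → w i ≢ v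
  w≢v zero = x≢v
  w≢v (suc zero) = y≢v
  w≢v (suc (suc zero)) = z≢v
  faces : ∀ i → Σ (Tri n) λ f → f ∈ F × f ≈ᵗ (v , w i , w (next i))
  faces zero = find xy
  faces (suc zero) = find yz
  faces (suc (suc zero)) = find zx
  covers′ : ∀ f → f ∈ F → v ∈ᵥ f → Σ (Fin 3) λ i → f ≈ᵗ (v , w i , w (next i))
  covers′ f f∈F v∈f with All.lookup covers f∈F v∈f
  ... | inj₁ f≈ = zero , f≈
  ... | inj₂ (inj₁ f≈) = suc zero , f≈
  ... | inj₂ (inj₂ f≈) = suc (suc zero) , f≈

-- Counting edges

countᵇ-++ : ∀ {A : Set} (p : A → Bool) xs ys → countᵇ p (xs ++ ys) ≡ countᵇ p xs + countᵇ p ys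
countᵇ-++ p [] ys = refl
countᵇ-++ p (x ∷ xs) ys with p x
... | true = cong suc (countᵇ-++ p xs ys)
... | false = countᵇ-++ p xs ys

countᵇ-map : ∀ {A B : Set} (p : B → Bool) (f : A → B) xs → countᵇ p (map f xs) ≡ countᵇ (p ∘ f) xs
countᵇ-map p f [] = refl
countᵇ-map p f (x ∷ xs) with p (f x)
... | true = cong suc (countᵇ-map p f xs)
... | false = countᵇ-map p f xs

countᵇ-cong : ∀ {A : Set} {p q : A → Bool} → (∀ x → p x ≡ q x) → ∀ xs → countᵇ p xs ≡ countᵇ q xs
countᵇ-cong p≗q [] = refl
countᵇ-cong {p = p} {q} p≗q (x ∷ xs) with p x | q x | p≗q x
... | true | true | refl = cong suc (countᵇ-cong p≗q xs)
... | false | false | refl = countᵇ-cong p≗q xs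

countᵇ-false : ∀ {A : Set} (xs : List A) → countᵇ (λ _ → false) xs ≡ 0
countᵇ-false [] = refl
countᵇ-false (x ∷ xs) = countᵇ-false xs

countᵇ-∨ : ∀ {A : Set} (p q : A → Bool) → (∀ x → p x ∧ q x ≡ false) → ∀ xs
  → countᵇ (λ x → p x ∨ q x) xs ≡ countᵇ p xs + countᵇ q xs
countᵇ-∨ p q disjoint [] = refl
countᵇ-∨ p q disjoint (x ∷ xs) with p x | q x | disjoint x
... | true | false | _ = cong suc (countᵇ-∨ p q disjoint xs)
... | false | true | _ = trans (cong suc (countᵇ-∨ p q disjoint xs)) (sym (+-suc _ _))
... | false | false | _ = countᵇ-∨ p q disjoint xs

countᵇ-concatMap : ∀ {A B : Set} (p : B → Bool) (f : A → List B) xs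
  → countᵇ p (concatMap f xs) ≡ sum (map (countᵇ p ∘ f) xs)
countᵇ-concatMap p f [] = refl
countᵇ-concatMap p f (x ∷ xs) = trans (countᵇ-++ p (f x) (concatMap f xs)) (cong (_ +_) (countᵇ-concatMap p f xs))

allFin-suc : ∀ n → allFin (suc n) ≡ zero ∷ map suc (allFin n)
allFin-suc n = cong (zero ∷_) (sym (map-tabulate (λ i → i) suc))

countᵇ-≟ : ∀ {n} (a : Fin n) → countᵇ (λ j → does (j ≟ᶠ a)) (allFin n) ≡ 1
countᵇ-≟ {suc n} zero = begin
  countᵇ (λ j → does (j ≟ᶠ zero)) (allFin (suc n))            ≡⟨ cong (countᵇ (λ j → does (j ≟ᶠ zero))) (allFin-suc n) ⟩
  suc (countᵇ (λ j → does (j ≟ᶠ zero)) (map suc (allFin n)))  ≡⟨ cong suc (countᵇ-map _ suc (allFin n)) ⟩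
  suc (countᵇ (λ _ → false) (allFin n))                       ≡⟨ cong suc (countᵇ-false (allFin n)) ⟩
  1                                                           ∎
  where open ≡-Reasoning
countᵇ-≟ {suc n} (suc a) = begin
  countᵇ (λ j → does (j ≟ᶠ suc a)) (allFin (suc n))      ≡⟨ cong (countᵇ (λ j → does (j ≟ᶠ suc a))) (allFin-suc n) ⟩
  countᵇ (λ j → does (j ≟ᶠ suc a)) (map suc (allFin n))  ≡⟨ countᵇ-map _ suc (allFin n) ⟩
  countᵇ (λ j → does (j ≟ᶠ a)) (allFin n)                ≡⟨ countᵇ-≟ a ⟩
  1                                                      ∎
  where open ≡-Reasoning

countᵇ-∈ᵥᵇ : ∀ {n} {a b c : Fin n} → a ≢ b → a ≢ c → b ≢ c → countᵇ (_∈ᵥᵇ (a , b , c)) (allFin n) ≡ 3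
countᵇ-∈ᵥᵇ {n} {a} {b} {c} a≢b a≢c b≢c = begin
  countᵇ (_∈ᵥᵇ (a , b , c)) (allFin n)
    ≡⟨ countᵇ-∨ (_≟? a) (λ j → (j ≟? b) ∨ (j ≟? c))
         (λ j → trans (Bool.∧-distribˡ-∨ (j ≟? a) _ _) (cong₂ _∨_ (disjoint a≢b j) (disjoint a≢c j))) (allFin n) ⟩
  countᵇ (_≟? a) (allFin n) + countᵇ (λ j → (j ≟? b) ∨ (j ≟? c)) (allFin n)
    ≡⟨ cong (countᵇ (_≟? a) (allFin n) +_) (countᵇ-∨ (_≟? b) (_≟? c) (disjoint b≢c) (allFin n)) ⟩
  countᵇ (_≟? a) (allFin n) + (countᵇ (_≟? b) (allFin n) + countᵇ (_≟? c) (allFin n))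
    ≡⟨ cong₂ _+_ (countᵇ-≟ a) (cong₂ _+_ (countᵇ-≟ b) (countᵇ-≟ c)) ⟩
  3 ∎
  where
  open ≡-Reasoning
  _≟?_ : Fin n → Fin n → Bool
  j ≟? x = does (j ≟ᶠ x)
  disjoint : ∀ {x y} → x ≢ y → ∀ j → (j ≟? x) ∧ (j ≟? y) ≡ false
  disjoint {x} {y} x≢y j with j ≟ᶠ x | j ≟ᶠ y
  ... | yes refl | yes refl = ⊥-elim (x≢y refl)
  ... | yes _ | no _ = refl
  ... | no _ | _ = refl

isUpEdgeᵇ : ∀ {n} → List (Tri n) → Fin n → Fin n → Bool
isUpEdgeᵇ F u v = does (toℕ u <? toℕ v) ∧ isEdgeᵇ F u v

upDegree : ∀ {n} → List (Tri n) → Fin n → ℕ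
upDegree {n} F u = countᵇ (isUpEdgeᵇ F u) (allFin n)

edgeCount-upDegree : ∀ {n} (F : List (Tri n)) → edgeCount F ≡ sum (map (upDegree F) (allFin n))
edgeCount-upDegree {n} F =
  trans (countᵇ-concatMap _ (λ i → map (i ,_) (allFin n)) (allFin n))
        (cong sum (map-cong (λ i → countᵇ-map _ (i ,_) (allFin n)) (allFin n)))

T-injective : ∀ {x y} → T x ⇔ T y → x ≡ y
T-injective {false} {false} _ = refl
T-injective {false} {true} x⇔y = ⊥-elim (Equivalence.from x⇔y _)
T-injective {true} {false} x⇔y = ⊥-elim (Equivalence.to x⇔y _)
T-injective {true} {true} _ = refl

T-≟ : ∀ {n} {x y : Fin n} → T (does (x ≟ᶠ y)) ⇔ x ≡ y
T-≟ {x = x} {y} with x ≟ᶠ y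
... | yes x≡y = mk⇔ (λ _ → x≡y) _
... | no x≢y = mk⇔ (λ ()) x≢y

T-∈ᵥᵇ : ∀ {n} {x : Fin n} {t} → T (x ∈ᵥᵇ t) ⇔ x ∈ᵥ t
T-∈ᵥᵇ {t = _ , _ , _} = ⇔-trans Bool.T-∨ (T-≟ ⊎-cong ⇔-trans Bool.T-∨ (T-≟ ⊎-cong T-≟))

T-isEdgeᵇ : ∀ {n} (F : List (Tri n)) {u v} → T (isEdgeᵇ F u v) ⇔ Any (λ s → u ∈ᵥ s × v ∈ᵥ s) F
T-isEdgeᵇ [] = mk⇔ (λ ()) (λ ())
T-isEdgeᵇ (s ∷ F) =
  ⇔-trans Bool.T-∨ (⇔-trans (⇔-trans Bool.T-∧ (T-∈ᵥᵇ ×-cong T-∈ᵥᵇ) ⊎-cong T-isEdgeᵇ F) (↔⇒⇔ (Any.∷↔ _)))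

-- Stacking preserves sphere triangulations

reach-trans : ∀ {n} {F : List (Tri n)} {u v w} → Reach F u v → Reach F v w → Reach F u w
reach-trans here r = r
reach-trans (step u~v r) r′ = step u~v (reach-trans r r′)

adj-sym : ∀ {n} {F : List (Tri n)} {u v} → Adj F u v → Adj F v u
adj-sym (u≢v , f , f∈F , u∈f , v∈f) = u≢v ∘ sym , f , f∈F , v∈f , u∈f

module Stacking {n} {a b c : Fin n} (t↑ : Sorted (a , b , c)) (F : List (Tri n)) where

  t : Tri n
  t = (a , b , c)

  G : List (Tri (suc n))
  G = stack (t ∷ F)

  a≢b : a ≢ b
  a≢b = Fin.<⇒≢ (proj₁ t↑)

  b≢c : b ≢ c
  b≢c = Fin.<⇒≢ (proj₂ t↑)

  a≢c : a ≢ c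
  a≢c = Fin.<⇒≢ (<-trans (proj₁ t↑) (proj₂ t↑))

  ∈G-sucᵗ : ∀ {s} → s ∈ F → sucᵗ s ∈ G
  ∈G-sucᵗ s∈F = Any.++⁺ˡ (Any.map⁺ (Any.map (cong sucᵗ) s∈F))

  ∈G-cone : ∀ {f} → f ∈ cone t → f ∈ G
  ∈G-cone = Any.++⁺ʳ (map sucᵗ F)

  ∈G-split : ∀ {f} → f ∈ G → (Σ (Tri n) λ s → s ∈ F × f ≡ sucᵗ s) ⊎ f ∈ cone t
  ∈G-split f∈G with Any.++⁻ (map sucᵗ F) f∈G
  ... | inj₁ f∈sucF = inj₁ (∈-map⁻ sucᵗ f∈sucF)
  ... | inj₂ f∈cone = inj₂ f∈cone

  stack-sorted : All Sorted F → All Sorted G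
  stack-sorted F↑ = All.++⁺ (All.map⁺ (All.map sucᵗ-sorted F↑)) cone-sorted
    where
    sucᵗ-sorted : ∀ {s} → Sorted s → Sorted (sucᵗ s)
    sucᵗ-sorted (p , q) = s≤s p , s≤s q
    cone-sorted : All Sorted (cone t)
    cone-sorted =
      (s≤s z≤n , s≤s (proj₁ t↑)) ∷ (s≤s z≤n , s≤s (proj₂ t↑)) ∷ (s≤s z≤n , s≤s (<-trans (proj₁ t↑) (proj₂ t↑))) ∷ []

  stack-unique : Unique (t ∷ F) → Unique G
  stack-unique (_ ∷ F!) = Unique.++⁺ (Unique.map⁺ sucᵗ-injective F!) cone-unique disjoint
    where
    cone-unique : Unique (cone t)
    cone-unique =
      ((λ { refl → a≢b refl }) ∷ (λ { refl → b≢c refl }) ∷ []) ∷ ((λ { refl → a≢b refl }) ∷ []) ∷ [] ∷ []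
    disjoint : ∀ {f} → ¬ (f ∈ map sucᵗ F × f ∈ cone t)
    disjoint (f∈sucF , f∈cone) with ∈-map⁻ sucᵗ f∈sucF
    ... | s , _ , refl = zero∉sucᵗ s (∈-cone-apex f∈cone)
      where
      ∈-cone-apex : ∀ {f} → f ∈ cone t → zero ∈ᵥ f
      ∈-cone-apex (here refl) = inj₁ refl
      ∈-cone-apex (there (here refl)) = inj₁ refl
      ∈-cone-apex (there (there (here refl))) = inj₁ refl

  link-apex : LinkIsCycle G zero
  link-apex = link-of-triangle zero (suc a) (suc b) (suc c)
    (a≢b ∘ Fin.suc-injective) (b≢c ∘ Fin.suc-injective) (a≢c ∘ Fin.suc-injective) (λ ()) (λ ()) (λ ())
    ( Any.++⁺ʳ (map sucᵗ F) (here ≈ᵗ-refl) , Any.++⁺ʳ (map sucᵗ F) (there (here ≈ᵗ-refl))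
    , Any.++⁺ʳ (map sucᵗ F) (there (there (here swap₂₃))) , All.tabulate (covers _))
    where
    covers : ∀ f → f ∈ G → zero ∈ᵥ f
      → f ≈ᵗ (zero , suc a , suc b) ⊎ f ≈ᵗ (zero , suc b , suc c) ⊎ f ≈ᵗ (zero , suc c , suc a)
    covers f f∈G 0∈f with ∈G-split f∈G
    ... | inj₁ (s , _ , refl) = ⊥-elim (zero∉sucᵗ s 0∈f)
    ... | inj₂ (here refl) = inj₁ ≈ᵗ-refl
    ... | inj₂ (there (here refl)) = inj₂ (inj₁ ≈ᵗ-refl)
    ... | inj₂ (there (there (here refl))) = inj₂ (inj₂ swap₂₃)

  link-∉ : ∀ {u m w} → ¬ (u ∈ᵥ t) → IsLinkCycle (t ∷ F) u m w → IsLinkCycle G (suc u) m (suc ∘ w)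
  link-∉ {u} {m} {w} u∉t (w-inj , w≢u , faces , covers) =
    w-inj ∘ Fin.suc-injective , (λ i → w≢u i ∘ Fin.suc-injective) , faces′ , covers′
    where
    faces′ : ∀ i → Σ (Tri (suc n)) λ f → f ∈ G × f ≈ᵗ (suc u , suc (w i) , suc (w (next i)))
    faces′ i with faces i
    ... | _ , here refl , t≈ = ⊥-elim (u∉t (proj₂ (t≈ u) (inj₁ refl)))
    ... | s , there s∈F , s≈ = sucᵗ s , ∈G-sucᵗ s∈F , sucᵗ-≈ᵗ s≈
    covers′ : ∀ f → f ∈ G → suc u ∈ᵥ f → Σ (Fin (3 + m)) λ i → f ≈ᵗ (suc u , suc (w i) , suc (w (next i)))
    covers′ f f∈G u∈f with ∈G-split f∈G
    ... | inj₂ f∈cone = ⊥-elim (u∉t (∈-cone⁻ t f∈cone u∈f))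
    ... | inj₁ (s , s∈F , refl) with covers s (there s∈F) (∈-sucᵗ⁻ s u∈f)
    ...   | i , s≈ = i , sucᵗ-≈ᵗ s≈

  -- The cycle of u is rotated so that t is its last face; the apex is inserted between the other two corners of t.
  module ApexInsertion (F↑ : All Sorted F) (t∉F : ∀ {s} → s ∈ F → t ≢ s) {u m} {w : Fin (3 + m) → Fin n}
                       (cyc : IsLinkCycle (t ∷ F) u m w) (t≈ : t ≈ᵗ (u , w (last m) , w zero)) where

    w′ : Fin (3 + suc m) → Fin (suc n)
    w′ zero = zero
    w′ (suc j) = suc (w j)

    w-inj : Injective _≡_ _≡_ w
    w-inj = proj₁ cyc

    w≢u : ∀ i → w i ≢ u
    w≢u = proj₁ (proj₂ cyc)

    faces : ∀ i → Σ (Tri n) λ s → s ∈ t ∷ F × s ≈ᵗ (u , w i , w (next i))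
    faces = proj₁ (proj₂ (proj₂ cyc))

    covers : ∀ s → s ∈ t ∷ F → u ∈ᵥ s → Σ (Fin (3 + m)) λ i → s ≈ᵗ (u , w i , w (next i))
    covers = proj₂ (proj₂ (proj₂ cyc))

    u∈t : u ∈ᵥ t
    u∈t = proj₂ (t≈ u) (inj₁ refl)

    t-at-last : t ≈ᵗ (u , w (last m) , w (next (last m)))
    t-at-last = subst (λ k → t ≈ᵗ (u , w (last m) , w k)) (sym (next-last m)) t≈

    other-corner : ∀ {z} → z ∈ᵥ t → z ≢ u → z ≡ w (last m) ⊎ z ≡ w zero
    other-corner z∈t z≢u with proj₁ (t≈ _) z∈t
    ... | inj₁ z≡u = ⊥-elim (z≢u z≡u)
    ... | inj₂ z≡p⊎z≡q = z≡p⊎z≡q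

    w′-inj : Injective _≡_ _≡_ w′
    w′-inj {zero} {zero} _ = refl
    w′-inj {suc i} {suc j} e = cong suc (w-inj (Fin.suc-injective e))

    w′≢u : ∀ i → w′ i ≢ suc u
    w′≢u zero ()
    w′≢u (suc j) = w≢u j ∘ Fin.suc-injective

    Face : Fin (3 + suc m) → Set
    Face i = Σ (Tri (suc n)) λ f → f ∈ G × f ≈ᵗ (suc u , w′ i , w′ (next i))

    at-first : ∀ {f} → f ≈ᵗ (zero , suc u , suc (w zero)) → f ≈ᵗ (suc u , w′ zero , w′ (next zero))
    at-first {f} f≈ = subst (λ k → f ≈ᵗ (suc u , zero , w′ k)) (sym next-zero) (≈ᵗ-trans f≈ swap₁₂)

    at-last : ∀ {f} → f ≈ᵗ (zero , suc u , suc (w (last m))) → f ≈ᵗ (suc u , w′ (suc (last m)) , w′ (next (suc (last m))))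
    at-last {f} f≈ =
      subst (λ k → f ≈ᵗ (suc u , suc (w (last m)) , w′ k)) (sym (next-last (suc m))) (≈ᵗ-trans f≈ (≈ᵗ-trans swap₁₂ swap₂₃))

    at-suc : ∀ {s j} → suc (toℕ j) < 3 + m → s ≈ᵗ (u , w j , w (next j))
      → sucᵗ s ≈ᵗ (suc u , w′ (suc j) , w′ (next (suc j)))
    at-suc {s} {j} j+1<3+m s≈ = subst (λ k → sucᵗ s ≈ᵗ (suc u , suc (w j) , w′ k)) (sym (next-suc j j+1<3+m)) (sucᵗ-≈ᵗ s≈)

    first-face : Face zero
    first-face with cone-face u∈t (proj₂ (t≈ _) (inj₂ (inj₂ refl))) (w≢u zero ∘ sym)
    ... | f , f∈cone , f≈ = f , ∈G-cone f∈cone , at-first f≈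

    last-face : Face (suc (last m))
    last-face with cone-face u∈t (proj₂ (t≈ _) (inj₂ (inj₁ refl))) (w≢u (last m) ∘ sym)
    ... | f , f∈cone , f≈ = f , ∈G-cone f∈cone , at-last f≈

    faces′ : ∀ i → Face i
    faces′ zero = first-face
    faces′ (suc j) with last-or-< j
    ... | inj₁ refl = last-face
    ... | inj₂ j+1<3+m with faces j
    ...   | _ , here refl , t≈j = ⊥-elim (Fin.<⇒≢ j<last (link-index-unique cyc t≈j t-at-last))
      where
      j<last : toℕ j < toℕ (last m)
      j<last = subst (toℕ j <_) (sym (Fin.toℕ-fromℕ (2 + m))) (≤-pred j+1<3+m)
    ...   | s , there s∈F , s≈ = sucᵗ s , ∈G-sucᵗ s∈F , at-suc j+1<3+m s≈

    covers′ : ∀ f → f ∈ G → suc u ∈ᵥ f → Σ (Fin (3 + suc m)) λ i → f ≈ᵗ (suc u , w′ i , w′ (next i))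
    covers′ f f∈G u∈f with ∈G-split f∈G
    ... | inj₁ (s , s∈F , refl) with covers s (there s∈F) (∈-sucᵗ⁻ s u∈f)
    ...   | j , s≈ with last-or-< j
    ...     | inj₁ refl =
              ⊥-elim (t∉F s∈F (sym (sorted-≈ᵗ⇒≡ (All.lookup F↑ s∈F) t↑ (≈ᵗ-trans s≈ (≈ᵗ-sym t-at-last)))))
    ...     | inj₂ j+1<3+m = suc j , at-suc j+1<3+m s≈
    covers′ f f∈G u∈f | inj₂ f∈cone with cone-cover t↑ f∈cone u∈f
    ... | z , z∈t , z≢u , f≈ with other-corner z∈t z≢u
    ...   | inj₁ refl = suc (last m) , at-last f≈
    ...   | inj₂ refl = zero , at-first f≈

    link : IsLinkCycle G (suc u) (suc m) w′
    link = w′-inj , w′≢u , faces′ , covers′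

  stack-link : All Sorted F → (∀ {s} → s ∈ F → t ≢ s) → ∀ u → LinkIsCycle (t ∷ F) u → LinkIsCycle G (suc u)
  stack-link F↑ t∉F u (m , w , cyc@(_ , _ , _ , covers)) with u ∈ᵥ? t
  ... | no u∉t = m , suc ∘ w , link-∉ u∉t cyc
  ... | yes u∈t with covers t (here refl) u∈t
  ...   | i , t≈ with rotate-to-last (toℕ i) w i refl cyc t≈
  ...     | w₁ , cyc₁ , t≈₁ = suc m , ApexInsertion.w′ F↑ t∉F cyc₁ t≈₁ , ApexInsertion.link F↑ t∉F cyc₁ t≈₁

  adj-suc : ∀ {x y} → Adj (t ∷ F) x y → Adj G (suc x) (suc y)
  adj-suc (x≢y , _ , here refl , x∈t , y∈t) with cone-face x∈t y∈t x≢y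
  ... | f , f∈cone , f≈ =
    x≢y ∘ Fin.suc-injective , f , ∈G-cone f∈cone , proj₂ (f≈ _) (inj₂ (inj₁ refl)) , proj₂ (f≈ _) (inj₂ (inj₂ refl))
  adj-suc (x≢y , s , there s∈F , x∈s , y∈s) =
    x≢y ∘ Fin.suc-injective , sucᵗ s , ∈G-sucᵗ s∈F , ∈-sucᵗ⁺ x∈s , ∈-sucᵗ⁺ y∈s

  reach-suc : ∀ {x y} → Reach (t ∷ F) x y → Reach G (suc x) (suc y)
  reach-suc here = here
  reach-suc (step x~y r) = step (adj-suc x~y) (reach-suc r)

  apex~a : Adj G zero (suc a)
  apex~a = (λ ()) , _ , ∈G-cone (here refl) , inj₁ refl , inj₂ (inj₁ refl)

  stack-connected : Connected (t ∷ F) → Connected G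
  stack-connected conn zero zero = here
  stack-connected conn zero (suc v) = step apex~a (reach-suc (conn a v))
  stack-connected conn (suc u) zero = reach-trans (reach-suc (conn u a)) (step (adj-sym apex~a) here)
  stack-connected conn (suc u) (suc v) = reach-suc (conn u v)

  cone-∋ : ∀ {x} → x ∈ᵥ t → Any (λ f → zero ∈ᵥ f × suc x ∈ᵥ f) (cone t)
  cone-∋ (inj₁ refl) = here (inj₁ refl , inj₂ (inj₁ refl))
  cone-∋ (inj₂ (inj₁ refl)) = here (inj₁ refl , inj₂ (inj₂ refl))
  cone-∋ (inj₂ (inj₂ refl)) = there (here (inj₁ refl , inj₂ (inj₂ refl)))

  apex-edge : ∀ {x} → Any (λ f → zero ∈ᵥ f × suc x ∈ᵥ f) G ⇔ x ∈ᵥ t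
  apex-edge = mk⇔ to (Any.++⁺ʳ (map sucᵗ F) ∘ cone-∋)
    where
    to : ∀ {x} → Any (λ f → zero ∈ᵥ f × suc x ∈ᵥ f) G → x ∈ᵥ t
    to e with Any.++⁻ (map sucᵗ F) e
    ... | inj₁ e′ with find (Any.map⁻ e′)
    ...   | s , _ , 0∈s , _ = ⊥-elim (zero∉sucᵗ s 0∈s)
    to e | inj₂ e′ with find e′
    ...   | _ , f∈cone , _ , x∈f = ∈-cone⁻ t f∈cone x∈f

  shifted-edge : ∀ {x y} → x ≢ y
    → Any (λ f → suc x ∈ᵥ f × suc y ∈ᵥ f) G ⇔ Any (λ s → x ∈ᵥ s × y ∈ᵥ s) (t ∷ F)
  shifted-edge {x} {y} x≢y = mk⇔ to from
    where
    to : Any (λ f → suc x ∈ᵥ f × suc y ∈ᵥ f) G → Any (λ s → x ∈ᵥ s × y ∈ᵥ s) (t ∷ F)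
    to e with Any.++⁻ (map sucᵗ F) e
    ... | inj₁ e′ = there (Any.map (λ {s} (x∈ , y∈) → ∈-sucᵗ⁻ s x∈ , ∈-sucᵗ⁻ s y∈) (Any.map⁻ e′))
    ... | inj₂ e′ with find e′
    ...   | _ , f∈cone , x∈f , y∈f = here (∈-cone⁻ t f∈cone x∈f , ∈-cone⁻ t f∈cone y∈f)
    from : Any (λ s → x ∈ᵥ s × y ∈ᵥ s) (t ∷ F) → Any (λ f → suc x ∈ᵥ f × suc y ∈ᵥ f) G
    from (here (x∈t , y∈t)) with cone-face x∈t y∈t x≢y
    ... | f , f∈cone , f≈ =
      Any.++⁺ʳ (map sucᵗ F) (lose f∈cone (proj₂ (f≈ _) (inj₂ (inj₁ refl)) , proj₂ (f≈ _) (inj₂ (inj₂ refl))))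
    from (there e) = Any.++⁺ˡ (Any.map⁺ (Any.map (λ (x∈ , y∈) → ∈-sucᵗ⁺ x∈ , ∈-sucᵗ⁺ y∈) e))

  upDegree-apex : upDegree G zero ≡ 3
  upDegree-apex = begin
    countᵇ (isUpEdgeᵇ G zero) (allFin (suc n))        ≡⟨ cong (countᵇ (isUpEdgeᵇ G zero)) (allFin-suc n) ⟩
    countᵇ (isUpEdgeᵇ G zero) (map suc (allFin n))    ≡⟨ countᵇ-map (isUpEdgeᵇ G zero) suc (allFin n) ⟩
    countᵇ (isEdgeᵇ G zero ∘ suc) (allFin n)          ≡⟨ countᵇ-cong apex-edgeᵇ (allFin n) ⟩
    countᵇ (_∈ᵥᵇ t) (allFin n)                        ≡⟨ countᵇ-∈ᵥᵇ a≢b a≢c b≢c ⟩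
    3                                                 ∎
    where
    open ≡-Reasoning
    apex-edgeᵇ : ∀ x → isEdgeᵇ G zero (suc x) ≡ x ∈ᵥᵇ t
    apex-edgeᵇ x = T-injective (⇔-trans (T-isEdgeᵇ G) (⇔-trans apex-edge (⇔-sym T-∈ᵥᵇ)))

  upDegree-suc : ∀ x → upDegree G (suc x) ≡ upDegree (t ∷ F) x
  upDegree-suc x = begin
    countᵇ (isUpEdgeᵇ G (suc x)) (allFin (suc n))        ≡⟨ cong (countᵇ (isUpEdgeᵇ G (suc x))) (allFin-suc n) ⟩
    countᵇ (isUpEdgeᵇ G (suc x)) (map suc (allFin n))    ≡⟨ countᵇ-map (isUpEdgeᵇ G (suc x)) suc (allFin n) ⟩
    countᵇ (isUpEdgeᵇ G (suc x) ∘ suc) (allFin n)        ≡⟨ countᵇ-cong up-edge (allFin n) ⟩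
    countᵇ (isUpEdgeᵇ (t ∷ F) x) (allFin n)              ∎
    where
    open ≡-Reasoning
    up-edge : ∀ y → isUpEdgeᵇ G (suc x) (suc y) ≡ isUpEdgeᵇ (t ∷ F) x y
    up-edge y with toℕ x <ᵇ toℕ y in x<ᵇy
    ... | false = refl
    ... | true = T-injective (⇔-trans (T-isEdgeᵇ G) (⇔-trans (shifted-edge x≢y) (⇔-sym (T-isEdgeᵇ (t ∷ F)))))
      where
      x≢y : x ≢ y
      x≢y = Fin.<⇒≢ (<ᵇ⇒< (toℕ x) (toℕ y) (subst T (sym x<ᵇy) _))

  stack-edgeCount : edgeCount G ≡ 3 + edgeCount (t ∷ F)
  stack-edgeCount = begin
    edgeCount G                                                    ≡⟨ edgeCount-upDegree G ⟩
    sum (map (upDegree G) (allFin (suc n)))                        ≡⟨ cong (sum ∘ map (upDegree G)) (allFin-suc n) ⟩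
    upDegree G zero + sum (map (upDegree G) (map suc (allFin n)))  ≡⟨ cong₂ _+_ upDegree-apex (cong sum (sym (map-∘ (allFin n)))) ⟩
    3 + sum (map (upDegree G ∘ suc) (allFin n))                    ≡⟨ cong (λ xs → 3 + sum xs) (map-cong upDegree-suc (allFin n)) ⟩
    3 + sum (map (upDegree (t ∷ F)) (allFin n))                    ≡⟨ cong (3 +_) (edgeCount-upDegree (t ∷ F)) ⟨
    3 + edgeCount (t ∷ F)                                          ∎
    where open ≡-Reasoning

length-stack : ∀ {n} (t : Tri n) F → length (stack (t ∷ F)) ≡ 2 + length (t ∷ F)
length-stack t F = trans (length-++ (map sucᵗ F)) (trans (cong (_+ 3) (length-map sucᵗ F)) (+-comm (length F) 3))

IsSphereTriangulation-nonempty : ∀ {n} → ¬ IsSphereTriangulation {n} []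
IsSphereTriangulation-nonempty {zero} (_ , _ , _ , _ , ())
IsSphereTriangulation-nonempty {suc n} (_ , _ , links , _) with links zero
... | _ , _ , _ , _ , faces , _ with faces zero
...   | _ , () , _

stack-isSphere : ∀ {n} {F : List (Tri n)} → IsSphereTriangulation F → IsSphereTriangulation (stack F)
stack-isSphere {F = []} sphere = ⊥-elim (IsSphereTriangulation-nonempty sphere)
stack-isSphere {n} {(a , b , c) ∷ F} (t↑ ∷ F↑ , t∉F ∷ F! , links , conn , euler) =
  stack-sorted F↑ , stack-unique (t∉F ∷ F!) , links′ , stack-connected conn , euler′
  where
  open Stacking t↑ F
  links′ : ∀ v → LinkIsCycle G v
  links′ zero = link-apex
  links′ (suc u) = stack-link F↑ (All.lookup t∉F) u (links u)
  euler′ : suc n + length G ≡ 2 + edgeCount G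
  euler′ = begin
    suc n + length G                  ≡⟨ cong (suc n +_) (length-stack (a , b , c) F) ⟩
    suc n + (2 + length (t ∷ F))      ≡⟨ cong suc (trans (+-suc n _) (cong suc (+-suc n _))) ⟩
    3 + (n + length (t ∷ F))          ≡⟨ cong (3 +_) euler ⟩
    3 + (2 + edgeCount (t ∷ F))       ≡⟨ cong (2 +_) stack-edgeCount ⟨
    2 + edgeCount G                   ∎
    where open ≡-Reasoning

-- Iterated stacking and the colouring

stack^ : ∀ {n} k → List (Tri n) → List (Tri (k + n))
stack^ zero F = F
stack^ (suc k) F = stack (stack^ k F)

stack^-isSphere : ∀ {n} k {F : List (Tri n)} → IsSphereTriangulation F → IsSphereTriangulation (stack^ k F)
stack^-isSphere zero sphere = sphere
stack^-isSphere (suc k) sphere = stack-isSphere (stack^-isSphere k sphere)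

length-stack^ : ∀ {n} k {F : List (Tri n)} → IsSphereTriangulation F → length (stack^ k F) ≡ 2 * k + length F
length-stack^ zero sphere = refl
length-stack^ (suc k) {F} sphere with stack^ k F | stack^-isSphere k sphere | length-stack^ k sphere
... | [] | sphereₖ | _ = ⊥-elim (IsSphereTriangulation-nonempty sphereₖ)
... | t ∷ Fₖ | _ | lengthₖ = trans (length-stack t Fₖ) (trans (cong (2 +_) lengthₖ)
  (trans (sym (+-assoc 2 (2 * k) (length F))) (cong (_+ length F) (sym (*-suc 2 k)))))

Above : ∀ {n} → ℕ → Tri n → Set
Above r (x , y , z) = r ≤ toℕ x × r ≤ toℕ y × r ≤ toℕ z

TailAbove : ∀ {n} → ℕ → Tri n → Set
TailAbove r (_ , y , z) = r ≤ toℕ y × r ≤ toℕ z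

tailAbove? : ∀ {n} r (t : Tri n) → Dec (TailAbove r t)
tailAbove? r (_ , y , z) = (r ≤? toℕ y) ×-dec (r ≤? toℕ z)

-- The first k faces receive the k new vertices; every face of a cone keeps two older vertices.
stack^-split : ∀ {n} (F : List (Tri n)) k → k ≤ length F →
  Σ (List (Tri (k + n))) λ A → Σ (List (Tri (k + n))) λ B →
    stack^ k F ≡ A ++ B × All (Above k) A × All (TailAbove k) B × k + length A ≡ length F
stack^-split F zero _ = F , [] , sym (++-identityʳ F) , All.tabulate (λ _ → z≤n , z≤n , z≤n) , [] , refl
stack^-split {n} F (suc k) k<|F| with stack^-split F k (<⇒≤ k<|F|)
... | [] , B , _ , _ , _ , k+0≡|F| = ⊥-elim (<-irrefl (trans (sym (+-identityʳ k)) k+0≡|F|) k<|F|)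
... | t ∷ A , B , split , t↑ ∷ A↑ , B↑ , k+|tA|≡|F| =
  map sucᵗ A , map sucᵗ B ++ cone t , split′ ,
  All.map⁺ (All.map sucᵗ-above A↑) ,
  All.++⁺ (All.map⁺ {f = sucᵗ} (All.map (λ {s} → sucᵗ-tailAbove {s}) B↑)) (cone-tailAbove t t↑) ,
  trans (cong (λ l → suc (k + l)) (length-map sucᵗ A)) (trans (sym (+-suc k (length A))) k+|tA|≡|F|)
  where
  sucᵗ-above : ∀ {s : Tri (k + n)} → Above k s → Above (suc k) (sucᵗ s)
  sucᵗ-above {_ , _ , _} (p , q , r) = s≤s p , s≤s q , s≤s r
  sucᵗ-tailAbove : ∀ {s : Tri (k + n)} → TailAbove k s → TailAbove (suc k) (sucᵗ s)
  sucᵗ-tailAbove {_ , _ , _} (q , r) = s≤s q , s≤s r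
  cone-tailAbove : ∀ (s : Tri (k + n)) → Above k s → All (TailAbove (suc k)) (cone s)
  cone-tailAbove _ (p , q , r) = (s≤s p , s≤s q) ∷ (s≤s q , s≤s r) ∷ (s≤s p , s≤s r) ∷ []
  split′ : stack (stack^ k F) ≡ map sucᵗ A ++ (map sucᵗ B ++ cone t)
  split′ = begin
    stack (stack^ k F)                    ≡⟨ cong stack split ⟩
    map sucᵗ (A ++ B) ++ cone t           ≡⟨ cong (_++ cone t) (map-++ sucᵗ A B) ⟩
    (map sucᵗ A ++ map sucᵗ B) ++ cone t  ≡⟨ ++-assoc (map sucᵗ A) (map sucᵗ B) (cone t) ⟩
    map sucᵗ A ++ (map sucᵗ B ++ cone t)  ∎
    where open ≡-Reasoning

stack^-tailAbove : ∀ {n} (F : List (Tri n)) k → k ≤ length F → All (TailAbove k) (stack^ k F)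
stack^-tailAbove {n} F k k≤|F| with stack^-split F k k≤|F|
... | A , B , split , A↑ , B↑ , _ =
  subst (All (TailAbove k)) (sym split) (All.++⁺ (All.map (λ {s} → above⇒tailAbove {s}) A↑) B↑)
  where
  above⇒tailAbove : ∀ {s : Tri (k + n)} → Above k s → TailAbove k s
  above⇒tailAbove {_ , _ , _} (_ , q , r) = q , r

lowColouring : ∀ {N} r → Fin N → Fin (suc r)
lowColouring r v with toℕ v <? r
... | yes v<r = suc (fromℕ< v<r)
... | no _ = zero

lowColouring-≥ : ∀ {N} r {v : Fin N} → r ≤ toℕ v → lowColouring r v ≡ zero
lowColouring-≥ r {v} r≤v with toℕ v <? r
... | yes v<r = ⊥-elim (<⇒≱ v<r r≤v)
... | no _ = refl

lowColouring-surjective : ∀ {N} r → r < N → Surjective (lowColouring {N} r)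
lowColouring-surjective r r<N zero = fromℕ< r<N , lowColouring-≥ r (≤-reflexive (sym (Fin.toℕ-fromℕ< r<N)))
lowColouring-surjective {N} r r<N (suc y) = v , colour-v
  where
  y<N : toℕ y < N
  y<N = <-trans (Fin.toℕ<n y) r<N
  v : Fin N
  v = fromℕ< y<N
  colour-v : lowColouring r v ≡ suc y
  colour-v with toℕ v <? r
  ... | yes v<r = cong suc (Fin.toℕ-injective (trans (Fin.toℕ-fromℕ< v<r) (Fin.toℕ-fromℕ< y<N)))
  ... | no v≮r = ⊥-elim (v≮r (subst (_< r) (sym (Fin.toℕ-fromℕ< y<N)) (Fin.toℕ<n y)))

tailAbove⇒nonRainbow : ∀ {N} r {F : List (Tri N)} → All (TailAbove r) F → NonRainbow F (lowColouring r)
tailAbove⇒nonRainbow r F↑ (_ , y , z) t∈F (_ , y≢z , _) with All.lookup F↑ t∈F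
... | r≤y , r≤z = y≢z (trans (lowColouring-≥ r r≤y) (sym (lowColouring-≥ r r≤z)))

HasNonRainbowSphere : ℕ → ℕ → Set
HasNonRainbowSphere n k =
  Σ (List (Tri n)) λ F → IsSphereTriangulation F × Σ (Fin n → Fin k) λ c → Surjective c × NonRainbow F c

IsSphereTriangulation-vertices : ∀ {n} {F : List (Tri n)} → IsSphereTriangulation F → 0 < n
IsSphereTriangulation-vertices {zero} {[]} sphere = ⊥-elim (IsSphereTriangulation-nonempty sphere)
IsSphereTriangulation-vertices {suc n} _ = s≤s z≤n

tailAbove⇒hasNonRainbowSphere : ∀ {N} r {F : List (Tri N)} → r < N → IsSphereTriangulation F → All (TailAbove r) F
  → HasNonRainbowSphere N (suc r)
tailAbove⇒hasNonRainbowSphere r r<N sphere F↑ =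
  _ , sphere , lowColouring r , lowColouring-surjective r r<N , tailAbove⇒nonRainbow r F↑

stack^-hasNonRainbowSphere : ∀ {N} {F : List (Tri N)} r → IsSphereTriangulation F → r ≤ length F
  → HasNonRainbowSphere (r + N) (suc r)
stack^-hasNonRainbowSphere {F = F} r sphere r≤|F| =
  tailAbove⇒hasNonRainbowSphere r (m<m+n r (IsSphereTriangulation-vertices sphere)) (stack^-isSphere r sphere)
    (stack^-tailAbove F r r≤|F|)

K₄ : List (Tri 4)
K₄ = (# 1 , # 2 , # 3) ∷ (# 0 , # 1 , # 2) ∷ (# 0 , # 1 , # 3) ∷ (# 0 , # 2 , # 3) ∷ []

K₄-isSphere : IsSphereTriangulation K₄
K₄-isSphere =
  from-yes (All.all? sorted? K₄) , from-yes (AllPairs.allPairs? (λ s t → ¬? (≡-dec _≟ᶠ_ (≡-dec _≟ᶠ_ _≟ᶠ_) s t)) K₄) ,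
  links , connected , refl
  where
  sorted? : ∀ t → Dec (Sorted t)
  sorted? (a , b , c) = (toℕ a <? toℕ b) ×-dec (toℕ b <? toℕ c)
  links : ∀ v → LinkIsCycle K₄ v
  links zero = link-of-triangle (# 0) (# 1) (# 2) (# 3) (λ ()) (λ ()) (λ ()) (λ ()) (λ ()) (λ ())
    (from-yes (triangleLink? K₄ (# 0) (# 1) (# 2) (# 3)))
  links (suc zero) = link-of-triangle (# 1) (# 0) (# 2) (# 3) (λ ()) (λ ()) (λ ()) (λ ()) (λ ()) (λ ())
    (from-yes (triangleLink? K₄ (# 1) (# 0) (# 2) (# 3)))
  links (suc (suc zero)) = link-of-triangle (# 2) (# 0) (# 1) (# 3) (λ ()) (λ ()) (λ ()) (λ ()) (λ ()) (λ ())
    (from-yes (triangleLink? K₄ (# 2) (# 0) (# 1) (# 3)))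
  links (suc (suc (suc zero))) = link-of-triangle (# 3) (# 0) (# 1) (# 2) (λ ()) (λ ()) (λ ()) (λ ()) (λ ()) (λ ())
    (from-yes (triangleLink? K₄ (# 3) (# 0) (# 1) (# 2)))
  complete : ∀ u v → Any (λ t → u ∈ᵥ t × v ∈ᵥ t) K₄
  complete = from-yes (Fin.all? (λ u → Fin.all? (λ v → Any.any? (λ t → u ∈ᵥ? t ×-dec v ∈ᵥ? t) K₄)))
  connected : Connected K₄
  connected u v with u ≟ᶠ v | find (complete u v)
  ... | yes refl | _ = here
  ... | no u≢v | t , t∈K₄ , u∈t , v∈t = step (u≢v , t , t∈K₄ , u∈t , v∈t) here

stack^-K₄ : ∀ a r → r ≤ 2 * a + 4 → HasNonRainbowSphere (r + (a + 4)) (suc r)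
stack^-K₄ a r r≤2a+4 =
  stack^-hasNonRainbowSphere r (stack^-isSphere a K₄-isSphere) (subst (r ≤_) (sym (length-stack^ a K₄-isSphere)) r≤2a+4)

stacking-parameters : ∀ m → Σ ℕ λ a → Σ ℕ λ r →
  r ≤ 2 * a + 4 × r + (a + 4) ≡ 6 + m × suc r ≡ (2 * (6 + m) ∸ 1) / 3
stacking-parameters 0 = 0 , 2 , s≤s (s≤s z≤n) , refl , refl
stacking-parameters 1 = 0 , 3 , s≤s (s≤s (s≤s z≤n)) , refl , refl
stacking-parameters 2 = 0 , 4 , ≤-refl , refl , refl
stacking-parameters (suc (suc (suc m))) with stacking-parameters m
... | a , r , r≤2a+4 , vertices , colours =
  suc a , 2 + r , subst (2 + r ≤_) (cong (_+ 4) (sym (*-suc 2 a))) (s≤s (s≤s r≤2a+4)) ,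
  cong (2 +_) (trans (+-suc r (a + 4)) (cong suc vertices)) , colours′
  where
  open ≡-Reasoning
  2[6+k]∸1 : ∀ k → 2 * (6 + k) ∸ 1 ≡ 11 + 2 * k
  2[6+k]∸1 k = cong (_∸ 1) (*-distribˡ-+ 2 6 k)
  colours′ : 3 + r ≡ (2 * (6 + (3 + m)) ∸ 1) / 3
  colours′ = begin
    2 + suc r                    ≡⟨ cong (2 +_) (trans colours (/-congˡ {o = 3} (2[6+k]∸1 m))) ⟩
    2 + (11 + 2 * m) / 3         ≡⟨ cong suc (m/n≡1+[m∸n]/n {14 + 2 * m} {3} (s≤s (s≤s (s≤s z≤n)))) ⟨
    1 + (14 + 2 * m) / 3         ≡⟨ m/n≡1+[m∸n]/n {17 + 2 * m} {3} (s≤s (s≤s (s≤s z≤n))) ⟨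
    (17 + 2 * m) / 3             ≡⟨ /-congˡ {o = 3} (cong (11 +_) (*-distribˡ-+ 2 3 m)) ⟨
    (11 + 2 * (3 + m)) / 3       ≡⟨ /-congˡ {o = 3} (2[6+k]∸1 (3 + m)) ⟨
    (2 * (6 + (3 + m)) ∸ 1) / 3  ∎

proposition1 : ∀ (n : ℕ) → 4 ≤ n →
    Σ (List (Tri n)) λ F → IsSphereTriangulation F ×
    Σ (Fin n → Fin ((2 * n ∸ 1) / 3)) λ c → Surjective c × NonRainbow F c
proposition1 0 ()
proposition1 1 (s≤s ())
proposition1 2 (s≤s (s≤s ()))
proposition1 3 (s≤s (s≤s (s≤s ())))
proposition1 4 _ = tailAbove⇒hasNonRainbowSphere 1 (s≤s (s≤s z≤n)) K₄-isSphere (from-yes (All.all? (tailAbove? 1) K₄))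
proposition1 5 _ =
  tailAbove⇒hasNonRainbowSphere 2 (s≤s (s≤s (s≤s z≤n))) (stack-isSphere K₄-isSphere)
    (from-yes (All.all? (tailAbove? 2) (stack K₄)))
proposition1 (suc (suc (suc (suc (suc (suc m)))))) _ with stacking-parameters m
... | a , r , r≤2a+4 , vertices , colours = subst₂ HasNonRainbowSphere vertices colours (stack^-K₄ a r r≤2a+4)
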